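{- Let $X=\{x,y,z\}$ and $N=\{1,\dots,n\}$ with $n\ge 3$, and let $g:NP\to X$ be a strategy-proof social choice rule. If $g|NP^{*}$ has a range consisting of just one alternative, then $g$ is not of full range on $NP$, i.e. $\mathrm{Range}(g)\neq X$.
   Context: A profile is a map $p:N\to L(X)$, where $L(X)$ is the set of strict linear orderings of $X$; write $a\succ_{p(i)}b$ if individual $i$ strictly prefers $a$ to $b$ at $p$. $NP$ is the set of all profiles $p$ such that for every pair of distinct alternatives $a,b$ there exist individuals $i,j$ with $a\succ_{p(i)}b$ and $b\succ_{p(j)}a$. $NP^{*}$ is the set of profiles $u\in NP$ with $u(n-1)=u(n)$. Two profiles $p,q$ are $h$-variants if $q(i)=p(i)$ for all $i\neq h$. A rule $g:NP\to X$ is strategy-proof if there are no $h\in N$ and $h$-variants $p,p'\in NP$ with $g(p')\succ_{p(h)}g(p)$. -}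

module Defs where

open import Data.Nat using (ℕ; suc; _≤_; s≤s)
open import Data.Fin using (Fin; _<_; fromℕ<)
open import Data.Fin.Properties using ()
open import Data.Product using (Σ; ∃; _×_; _,_)
open import Relation.Nullary using (¬_)
open import Relation.Binary.PropositionalEquality using (_≡_)
open import Function.Definitions using (Injective)
open import Data.Nat.Properties using (≤-refl; n≤1+n)

X : Set
X = Fin 3

-- A strict linear ordering of X, encoded by an injective rank map:
-- rank a = 0 for the top alternative, 2 for the bottom one.
record LinOrd : Set where
  field
    rank     : X → Fin 3
    rank-inj : Injective _≡_ _≡_ rank
open LinOrd public

_≻[_]_ : X → LinOrd → X → Set
a ≻[ R ] b = rank R a < rank R b

-- Individuals N = {1,…,n}, encoded as Fin n (individual i+1 is index i).
Profile : ℕ → Set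
Profile n = Fin n → LinOrd

NP : {n : ℕ} → Profile n → Set
NP {n} p = (a b : X) → ¬ (a ≡ b) →
  Σ (Fin n) λ i → Σ (Fin n) λ j → (a ≻[ p i ] b) × (b ≻[ p j ] a)

indN : (n : ℕ) → 3 ≤ n → Fin n
indN (suc n) (s≤s _) = fromℕ< {n} {suc n} ≤-refl

indN-1 : (n : ℕ) → 3 ≤ n → Fin n
indN-1 (suc (suc n)) (s≤s (s≤s _)) = fromℕ< {n} {suc (suc n)} (s≤s (n≤1+n n))

NP* : (n : ℕ) → 3 ≤ n → Profile n → Set
NP* n h u = NP u × (u (indN-1 n h) ≡ u (indN n h))

Variant : {n : ℕ} → Fin n → Profile n → Profile n → Set
Variant {n} h p q = (i : Fin n) → ¬ (i ≡ h) → q i ≡ p i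

Rule : ℕ → Set
Rule n = (p : Profile n) → .(NP p) → X

StrategyProof : {n : ℕ} → Rule n → Set
StrategyProof {n} g = (h : Fin n) (p p' : Profile n) (np : NP p) (np' : NP p') →
  Variant h p p' → ¬ (g p' np' ≻[ p h ] g p np)

FullRange : {n : ℕ} → Rule n → Set
FullRange {n} g = (a : X) → Σ (Profile n) λ p → Σ (NP p) λ np → g p np ≡ a

RangeOnNP*IsSingleton : (n : ℕ) (h : 3 ≤ n) → Rule n → X → Set
RangeOnNP*IsSingleton n h g a =
  (Σ (Profile n) λ u → NP* n h u)
  × ((u : Profile n) (hu : NP* n h u) → g u (Data.Product.proj₁ hu) ≡ a)

-- Lemmas A and E: at any profile, no voter outside the pair {n - 1, n} ranks a above the
-- outcome, and the two pair voters do not both do so.  For an attained value t ≠ a, call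
-- a, t and the third alternative anchor, target and other.  By the transport lemma, a
-- profile with outcome t collapses, keeping the outcome, to one where all voters outside
-- the pair share an order; these form a finite model of triples of role orders.  There a
-- move is forced when strategy-proofness and Lemmas A, E leave t as the only outcome; a
-- fixed schedule of forced moves takes every admissible triple to a hub, from which forced
-- runs reach the meeting points (all checked by evaluation).  If t and the third value u
-- were both attained, the meeting points read in the frames of t and of u would give two
-- profiles with the same preferences, so t = u.
module Submission where

open import Defs
open import Data.Nat using (ℕ; zero; suc; _≤_; _<_; _<ᵇ_; _≡ᵇ_; z<s; s<s; s≤s)
open import Data.Nat.Properties
  using (≮⇒≥; <-≤-trans; ≤-<-trans; ∸-monoʳ-<; <ᵇ⇒<; <⇒<ᵇ; ≡ᵇ⇒≡; 0≢1+n; 1+n≢n; n≤1+n; ≤-refl; <⇒≤;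
         n<1+n; m<n⇒m<1+n; m<1+n⇒m<n∨m≡n; _<?_)
import Data.Nat.Properties as ℕₚ
open import Data.Fin using (Fin; zero; suc; toℕ; fromℕ<; opposite)
open import Data.Fin.Properties
  using (_≟_; <-cmp; <-irrefl; toℕ<n; toℕ-fromℕ<; toℕ-injective; opposite-prop; opposite-involutive)
open import Data.Bool using (Bool; true; false; _∧_; _∨_; not; T; if_then_else_)
open import Data.Bool.Properties using (T-∧; T-∨)
open import Data.Unit using (tt)
open import Data.Empty using (⊥; ⊥-elim)
open import Data.Product using (Σ; _×_; _,_; proj₁; proj₂)
open import Data.Sum using (_⊎_; inj₁; inj₂)
open import Data.List using (List; []; _∷_; foldl)
open import Function.Bundles using (Equivalence)
open import Relation.Nullary using (¬_; yes; no)
open import Relation.Binary using (tri<; tri≈; tri>)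
open import Relation.Binary.PropositionalEquality using (_≡_; _≢_; refl; sym; trans; cong; subst; subst₂; ≢-sym)

pattern 𝟎 = zero
pattern 𝟏 = suc zero
pattern 𝟐 = suc (suc zero)

prefer-total : ∀ R {x y} → x ≢ y → x ≻[ R ] y ⊎ y ≻[ R ] x
prefer-total R {x} {y} x≢y with <-cmp (rank R x) (rank R y)
... | tri< x≻y _ _ = inj₁ x≻y
... | tri≈ _ same _ = ⊥-elim (x≢y (rank-inj R same))
... | tri> _ _ y≻x = inj₂ y≻x

-- Neither alternative strictly preferred means they are equal; this turns the two
-- directions of strategy-proofness into equalities of outcomes.
indifferent : ∀ R {x y} → ¬ x ≻[ R ] y → ¬ y ≻[ R ] x → x ≡ y
indifferent R {x} {y} x⊁y y⊁x with x ≟ y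
... | yes x≡y = x≡y
... | no x≢y with prefer-total R x≢y
...   | inj₁ x≻y = ⊥-elim (x⊁y x≻y)
...   | inj₂ y≻x = ⊥-elim (y⊁x y≻x)

prefer-irrefl : ∀ R {x} → ¬ x ≻[ R ] x
prefer-irrefl R = <-irrefl refl

≻-≽-trans : ∀ R {x y z} → x ≻[ R ] y → ¬ z ≻[ R ] y → x ≻[ R ] z
≻-≽-trans R x≻y z⊁y = <-≤-trans x≻y (≮⇒≥ z⊁y)

≽-≻-trans : ∀ R {x y z} → ¬ y ≻[ R ] x → y ≻[ R ] z → x ≻[ R ] z
≽-≻-trans R y⊁x y≻z = ≤-<-trans (≮⇒≥ y⊁x) y≻z

reverse : LinOrd → LinOrd
reverse R = record { rank = λ x → opposite (rank R x) ; rank-inj = λ e → rank-inj R (opposite-injective e) }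
  where
  opposite-injective : ∀ {i j : Fin 3} → opposite i ≡ opposite j → i ≡ j
  opposite-injective {i} {j} e =
    trans (sym (opposite-involutive i)) (trans (cong opposite e) (opposite-involutive j))

reverse-flips : ∀ R {x y} → x ≻[ R ] y → y ≻[ reverse R ] x
reverse-flips R {x} {y} x≻y =
  subst₂ _<_ (sym (opposite-prop (rank R y))) (sym (opposite-prop (rank R x)))
    (∸-monoʳ-< (s<s x≻y) (toℕ<n (rank R y)))

Agrees : LinOrd → LinOrd → Set
Agrees R R' = ∀ x y → x ≻[ R ] y → x ≻[ R' ] y

agrees-≡ : ∀ {R R'} → R ≡ R' → Agrees R R'
agrees-≡ refl x y x≻y = x≻y

-- The alternative distinct from a and t (a junk value when a = t).
third : X → X → X
third 𝟎 𝟏 = 𝟐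
third 𝟏 𝟎 = 𝟐
third 𝟎 𝟐 = 𝟏
third 𝟐 𝟎 = 𝟏
third 𝟏 𝟐 = 𝟎
third 𝟐 𝟏 = 𝟎
third _ _ = 𝟎

third-unique : ∀ {a t y} → a ≢ t → y ≢ a → y ≢ t → y ≡ third a t
third-unique {𝟎} {𝟏} {𝟐} _ _ _ = refl
third-unique {𝟏} {𝟎} {𝟐} _ _ _ = refl
third-unique {𝟎} {𝟐} {𝟏} _ _ _ = refl
third-unique {𝟐} {𝟎} {𝟏} _ _ _ = refl
third-unique {𝟏} {𝟐} {𝟎} _ _ _ = refl
third-unique {𝟐} {𝟏} {𝟎} _ _ _ = refl
third-unique {𝟎} {𝟎} a≢t _ _ = ⊥-elim (a≢t refl)
third-unique {𝟏} {𝟏} a≢t _ _ = ⊥-elim (a≢t refl)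
third-unique {𝟐} {𝟐} a≢t _ _ = ⊥-elim (a≢t refl)
third-unique {𝟎} {_} {𝟎} _ y≢a _ = ⊥-elim (y≢a refl)
third-unique {𝟏} {_} {𝟏} _ y≢a _ = ⊥-elim (y≢a refl)
third-unique {𝟐} {_} {𝟐} _ y≢a _ = ⊥-elim (y≢a refl)
third-unique {_} {𝟎} {𝟎} _ _ y≢t = ⊥-elim (y≢t refl)
third-unique {_} {𝟏} {𝟏} _ _ y≢t = ⊥-elim (y≢t refl)
third-unique {_} {𝟐} {𝟐} _ _ y≢t = ⊥-elim (y≢t refl)

third-fresh : ∀ {a t} → a ≢ t → third a t ≢ a × third a t ≢ t
third-fresh {𝟎} {𝟏} _ = (λ ()) , (λ ())
third-fresh {𝟏} {𝟎} _ = (λ ()) , (λ ())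
third-fresh {𝟎} {𝟐} _ = (λ ()) , (λ ())
third-fresh {𝟐} {𝟎} _ = (λ ()) , (λ ())
third-fresh {𝟏} {𝟐} _ = (λ ()) , (λ ())
third-fresh {𝟐} {𝟏} _ = (λ ()) , (λ ())
third-fresh {𝟎} {𝟎} a≢t = ⊥-elim (a≢t refl)
third-fresh {𝟏} {𝟏} a≢t = ⊥-elim (a≢t refl)
third-fresh {𝟐} {𝟐} a≢t = ⊥-elim (a≢t refl)

-- The third of a and third a t is t; this relates the frames of t and of third a t.
third-third : ∀ {a t} → a ≢ t → third a (third a t) ≡ t
third-third a≢t =
  sym (third-unique (≢-sym (proj₁ (third-fresh a≢t))) (≢-sym a≢t) (≢-sym (proj₂ (third-fresh a≢t))))

another : X → X
another 𝟎 = 𝟏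
another _ = 𝟎

another-fresh : ∀ a → another a ≢ a
another-fresh 𝟎 = λ ()
another-fresh 𝟏 = λ ()
another-fresh 𝟐 = λ ()

-- Boolean bookkeeping for the finite model, whose facts are decided by evaluation.

infixr 4 _⇒ᵇ_
_⇒ᵇ_ : Bool → Bool → Bool
b ⇒ᵇ c = not b ∨ c

modus : ∀ {b c} → T (b ⇒ᵇ c) → T b → T c
modus {true} c _ = c

∧-left : ∀ {b c} → T (b ∧ c) → T b
∧-left {b} p = proj₁ (Equivalence.to (T-∧ {b}) p)

∧-right : ∀ {b c} → T (b ∧ c) → T c
∧-right {b} p = proj₂ (Equivalence.to (T-∧ {b}) p)

∧-intro : ∀ {b c} → T b → T c → T (b ∧ c)
∧-intro {b} p q = Equivalence.from (T-∧ {b}) (p , q)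

∨-elim : ∀ {b c} → T (b ∨ c) → T b ⊎ T c
∨-elim {b} = Equivalence.to (T-∨ {b})

not-intro : ∀ {b} → (T b → ⊥) → T (not b)
not-intro {false} _ = tt
not-intro {true} refute = refute tt

not-elim : ∀ {b} → T (not b) → T b → ⊥
not-elim {false} _ ()

∨-introˡ : ∀ {b c} → T b → T (b ∨ c)
∨-introˡ {true} _ = tt

nor : ∀ {b c} → b ∨ c ≡ false → T (not b) × T (not c)
nor {false} {false} _ = tt , tt

-- Fix the anchor a (the value of g on NP*), an attained value t ≠ a and
-- the remaining alternative x; call them the roles anchor, target and other.  A RoleOrder is a
-- strict order of the roles, named by listing them from top to bottom.

data Role : Set where
  anchor target other : Role

data RoleOrder : Set where
  atx axt tax txa xat xta : RoleOrder

position : RoleOrder → Role → Fin 3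
position atx anchor = 𝟎
position atx target = 𝟏
position atx other  = 𝟐
position axt anchor = 𝟎
position axt target = 𝟐
position axt other  = 𝟏
position tax anchor = 𝟏
position tax target = 𝟎
position tax other  = 𝟐
position txa anchor = 𝟐
position txa target = 𝟎
position txa other  = 𝟏
position xat anchor = 𝟏
position xat target = 𝟐
position xat other  = 𝟎
position xta anchor = 𝟐
position xta target = 𝟏
position xta other  = 𝟎

-- Distinct roles occupy distinct positions, so interpreting a role order gives an injective
-- rank function.
positions-distinct : ∀ o → position o anchor ≢ position o target × position o anchor ≢ position o other
                                                                × position o target ≢ position o other
positions-distinct atx = (λ ()) , (λ ()) , (λ ())
positions-distinct axt = (λ ()) , (λ ()) , (λ ())
positions-distinct tax = (λ ()) , (λ ()) , (λ ())
positions-distinct txa = (λ ()) , (λ ()) , (λ ())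
positions-distinct xat = (λ ()) , (λ ()) , (λ ())
positions-distinct xta = (λ ()) , (λ ()) , (λ ())

position-injective : ∀ o {ρ ρ'} → position o ρ ≡ position o ρ' → ρ ≡ ρ'
position-injective o {anchor} {anchor} _ = refl
position-injective o {target} {target} _ = refl
position-injective o {other}  {other}  _ = refl
position-injective o {anchor} {target} e = ⊥-elim (proj₁ (positions-distinct o) e)
position-injective o {anchor} {other}  e = ⊥-elim (proj₁ (proj₂ (positions-distinct o)) e)
position-injective o {target} {other}  e = ⊥-elim (proj₂ (proj₂ (positions-distinct o)) e)
position-injective o {target} {anchor} e = ⊥-elim (proj₁ (positions-distinct o) (sym e))
position-injective o {other}  {anchor} e = ⊥-elim (proj₁ (proj₂ (positions-distinct o)) (sym e))
position-injective o {other}  {target} e = ⊥-elim (proj₂ (proj₂ (positions-distinct o)) (sym e))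

fromPositions : Fin 3 → Fin 3 → RoleOrder
fromPositions 𝟎 𝟏 = atx
fromPositions 𝟎 𝟐 = axt
fromPositions 𝟏 𝟎 = tax
fromPositions 𝟐 𝟎 = txa
fromPositions 𝟏 𝟐 = xat
fromPositions 𝟐 𝟏 = xta
fromPositions _ _ = atx

fromPositions-spec : ∀ {p q} → p ≢ q → position (fromPositions p q) anchor ≡ p
  × position (fromPositions p q) target ≡ q × position (fromPositions p q) other ≡ third p q
fromPositions-spec {𝟎} {𝟏} _ = refl , refl , refl
fromPositions-spec {𝟎} {𝟐} _ = refl , refl , refl
fromPositions-spec {𝟏} {𝟎} _ = refl , refl , refl
fromPositions-spec {𝟐} {𝟎} _ = refl , refl , refl
fromPositions-spec {𝟏} {𝟐} _ = refl , refl , refl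
fromPositions-spec {𝟐} {𝟏} _ = refl , refl , refl
fromPositions-spec {𝟎} {𝟎} p≢q = ⊥-elim (p≢q refl)
fromPositions-spec {𝟏} {𝟏} p≢q = ⊥-elim (p≢q refl)
fromPositions-spec {𝟐} {𝟐} p≢q = ⊥-elim (p≢q refl)

-- Exchanging the roles of target and other, e.g. when the model is reread from the point
-- of view of the other attained value.
swapRoles : Role → Role
swapRoles anchor = anchor
swapRoles target = other
swapRoles other  = target

relabel : RoleOrder → RoleOrder
relabel atx = axt
relabel axt = atx
relabel tax = xat
relabel txa = xta
relabel xat = tax
relabel xta = txa

relabel-position : ∀ o ρ → position (relabel o) ρ ≡ position o (swapRoles ρ)
relabel-position atx = λ { anchor → refl ; target → refl ; other → refl }
relabel-position axt = λ { anchor → refl ; target → refl ; other → refl }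
relabel-position tax = λ { anchor → refl ; target → refl ; other → refl }
relabel-position txa = λ { anchor → refl ; target → refl ; other → refl }
relabel-position xat = λ { anchor → refl ; target → refl ; other → refl }
relabel-position xta = λ { anchor → refl ; target → refl ; other → refl }

_≻⟨_⟩_ : Role → RoleOrder → Role → Bool
ρ ≻⟨ o ⟩ ρ' = toℕ (position o ρ) <ᵇ toℕ (position o ρ')

target-on-top : ∀ o → T ((target ≻⟨ o ⟩ anchor) ∧ (target ≻⟨ o ⟩ other)) →
                ∀ ρ → ρ ≢ target → T (target ≻⟨ o ⟩ ρ)
target-on-top o top anchor _ = ∧-left top
target-on-top o top other  _ = ∧-right {target ≻⟨ o ⟩ anchor} top
target-on-top o top target ρ≢target = ⊥-elim (ρ≢target refl)

-- A three-voter profile: the common order of all voters outside the pair {n-1, n}, the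
-- order of the pair voter ranking the anchor above the target, and that of the other one.
record Profile3 : Set where
  constructor ⟪_,_,_⟫
  field block dissenter ally : RoleOrder
open Profile3

data Seat : Set where
  blockSeat dissenterSeat allySeat : Seat

seat : Profile3 → Seat → RoleOrder
seat r blockSeat     = block r
seat r dissenterSeat = dissenter r
seat r allySeat      = ally r

reseat : Profile3 → Seat → RoleOrder → Profile3
reseat ⟪ o , d , l ⟫ blockSeat     o' = ⟪ o' , d , l ⟫
reseat ⟪ o , d , l ⟫ dissenterSeat o' = ⟪ o , o' , l ⟫
reseat ⟪ o , d , l ⟫ allySeat      o' = ⟪ o , d , o' ⟫

reseat-here : ∀ r v o → seat (reseat r v o) v ≡ o
reseat-here r blockSeat     o = refl
reseat-here r dissenterSeat o = refl
reseat-here r allySeat      o = refl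

reseat-elsewhere : ∀ r {v w} o → w ≢ v → seat (reseat r v o) w ≡ seat r w
reseat-elsewhere r {blockSeat}     {blockSeat}     o w≢v = ⊥-elim (w≢v refl)
reseat-elsewhere r {dissenterSeat} {dissenterSeat} o w≢v = ⊥-elim (w≢v refl)
reseat-elsewhere r {allySeat}      {allySeat}      o w≢v = ⊥-elim (w≢v refl)
reseat-elsewhere r {blockSeat}     {dissenterSeat} o _ = refl
reseat-elsewhere r {blockSeat}     {allySeat}      o _ = refl
reseat-elsewhere r {dissenterSeat} {blockSeat}     o _ = refl
reseat-elsewhere r {dissenterSeat} {allySeat}      o _ = refl
reseat-elsewhere r {allySeat}      {blockSeat}     o _ = refl
reseat-elsewhere r {allySeat}      {dissenterSeat} o _ = refl

someone : Profile3 → Role → Role → Bool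
someone r ρ ρ' = (ρ ≻⟨ block r ⟩ ρ') ∨ (ρ ≻⟨ dissenter r ⟩ ρ') ∨ (ρ ≻⟨ ally r ⟩ ρ')

np3 : Profile3 → Bool
np3 r = someone r anchor target ∧ someone r target anchor ∧ someone r anchor other
      ∧ someone r other anchor ∧ someone r target other ∧ someone r other target

-- The role ρ cannot be the outcome (Lemmas A and E below): the block ranks the anchor
-- above it, or both pair voters do.
excluded : Profile3 → Role → Bool
excluded r ρ = (anchor ≻⟨ block r ⟩ ρ) ∨ ((anchor ≻⟨ dissenter r ⟩ ρ) ∧ (anchor ≻⟨ ally r ⟩ ρ))

-- A seat changing its order from seat r v to o, with outcome target before, cannot produce
-- ρ: the change would be a manipulation in one direction or the other, or ρ is excluded.
rulesOut : Profile3 → Seat → RoleOrder → Role → Bool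
rulesOut r v o ρ = (ρ ≻⟨ seat r v ⟩ target) ∨ (target ≻⟨ o ⟩ ρ) ∨ excluded (reseat r v o) ρ

forces : Profile3 → Seat → RoleOrder → Bool
forces r v o = np3 (reseat r v o) ∧ rulesOut r v o anchor ∧ rulesOut r v o other

Move : Set
Move = Seat × RoleOrder

-- Perform a move if strategy-proofness forces the outcome to stay the target.
attempt : Profile3 → Move → Profile3
attempt r (v , o) = if forces r v o then reseat r v o else r

-- Runs are kept opaque so that symbolic runs are never unfolded during type checking;
-- they are computed only in the finite checks and in run-cons.
opaque
  run : Profile3 → List Move → Profile3
  run = foldl attempt

  run-nil : ∀ r → run r [] ≡ r
  run-nil r = refl

  run-cons : ∀ r m ms → run r (m ∷ ms) ≡ run (attempt r m) ms
  run-cons r m ms = refl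

valid : Profile3 → Bool
valid r = np3 r ∧ not (excluded r target) ∧ (anchor ≻⟨ dissenter r ⟩ target)

relabel3 : Profile3 → Profile3
relabel3 ⟪ o , d , l ⟫ = ⟪ relabel o , relabel d , relabel l ⟫

swapPair : Profile3 → Profile3
swapPair ⟪ o , d , l ⟫ = ⟪ o , l , d ⟫

seat-relabel3 : ∀ r v → seat (relabel3 r) v ≡ relabel (seat r v)
seat-relabel3 r blockSeat     = refl
seat-relabel3 r dissenterSeat = refl
seat-relabel3 r allySeat      = refl

np3-pair : ∀ r {ρ ρ'} → T (np3 r) → ρ ≢ ρ' → T (someone r ρ ρ')
np3-pair r {anchor} {anchor} _ ρ≢ρ' = ⊥-elim (ρ≢ρ' refl)
np3-pair r {target} {target} _ ρ≢ρ' = ⊥-elim (ρ≢ρ' refl)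
np3-pair r {other}  {other}  _ ρ≢ρ' = ⊥-elim (ρ≢ρ' refl)
np3-pair r {anchor} {target} p _ = ∧-left p
np3-pair r {target} {anchor} p _ = ∧-left (∧-right {someone r anchor target} p)
np3-pair r {anchor} {other}  p _ =
  ∧-left (∧-right {someone r target anchor} (∧-right {someone r anchor target} p))
np3-pair r {other}  {anchor} p _ =
  ∧-left (∧-right {someone r anchor other} (∧-right {someone r target anchor} (∧-right {someone r anchor target} p)))
np3-pair r {target} {other}  p _ =
  ∧-left (∧-right {someone r other anchor} (∧-right {someone r anchor other}
    (∧-right {someone r target anchor} (∧-right {someone r anchor target} p))))
np3-pair r {other}  {target} p _ =
  ∧-right {someone r target other} (∧-right {someone r other anchor} (∧-right {someone r anchor other}
    (∧-right {someone r target anchor} (∧-right {someone r anchor target} p))))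

someone-seat : ∀ r {ρ ρ'} → T (someone r ρ ρ') → Σ Seat λ v → T (ρ ≻⟨ seat r v ⟩ ρ')
someone-seat r {ρ} {ρ'} p with ∨-elim {ρ ≻⟨ block r ⟩ ρ'} p
... | inj₁ q = blockSeat , q
... | inj₂ p' with ∨-elim {ρ ≻⟨ dissenter r ⟩ ρ'} p'
...   | inj₁ q = dissenterSeat , q
...   | inj₂ q = allySeat , q

seat-someone : ∀ r v {ρ ρ'} → T (ρ ≻⟨ seat r v ⟩ ρ') → T (someone r ρ ρ')
seat-someone r blockSeat     {ρ} {ρ'} p = ∨-introˡ {ρ ≻⟨ block r ⟩ ρ'} p
seat-someone r dissenterSeat {ρ} {ρ'} p = Equivalence.from (T-∨ {ρ ≻⟨ block r ⟩ ρ'}) (inj₂ (∨-introˡ p))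
seat-someone r allySeat      {ρ} {ρ'} p =
  Equivalence.from (T-∨ {ρ ≻⟨ block r ⟩ ρ'}) (inj₂ (Equivalence.from (T-∨ {ρ ≻⟨ dissenter r ⟩ ρ'}) (inj₂ p)))

np3-intro : ∀ r → (∀ ρ ρ' → ρ ≢ ρ' → T (someone r ρ ρ')) → T (np3 r)
np3-intro r some =
  ∧-intro {someone r anchor target} (some anchor target λ ())
  (∧-intro {someone r target anchor} (some target anchor λ ())
  (∧-intro {someone r anchor other} (some anchor other λ ())
  (∧-intro {someone r other anchor} (some other anchor λ ())
  (∧-intro {someone r target other} (some target other λ ()) (some other target λ ())))))

excluded-cases : ∀ r ρ → T (excluded r ρ) →
  T (anchor ≻⟨ block r ⟩ ρ) ⊎ (T (anchor ≻⟨ dissenter r ⟩ ρ) × T (anchor ≻⟨ ally r ⟩ ρ))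
excluded-cases r ρ p with ∨-elim {anchor ≻⟨ block r ⟩ ρ} p
... | inj₁ q = inj₁ q
... | inj₂ q = inj₂ (∧-left q , ∧-right {anchor ≻⟨ dissenter r ⟩ ρ} q)

rulesOut-from-forces : ∀ r v o {ρ} → T (forces r v o) → ρ ≢ target → T (rulesOut r v o ρ)
rulesOut-from-forces r v o {anchor} p _ = ∧-left (∧-right {np3 (reseat r v o)} p)
rulesOut-from-forces r v o {other}  p _ = ∧-right {rulesOut r v o anchor} (∧-right {np3 (reseat r v o)} p)
rulesOut-from-forces r v o {target} _ ρ≢target = ⊥-elim (ρ≢target refl)

everyOrder : (RoleOrder → Bool) → Bool
everyOrder f = f atx ∧ f axt ∧ f tax ∧ f txa ∧ f xat ∧ f xta

everyOrder-sound : ∀ (f : RoleOrder → Bool) → T (everyOrder f) → ∀ o → T (f o)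
everyOrder-sound f p atx = ∧-left p
everyOrder-sound f p axt = ∧-left (∧-right {f atx} p)
everyOrder-sound f p tax = ∧-left (∧-right {f axt} (∧-right {f atx} p))
everyOrder-sound f p txa = ∧-left (∧-right {f tax} (∧-right {f axt} (∧-right {f atx} p)))
everyOrder-sound f p xat = ∧-left (∧-right {f txa} (∧-right {f tax} (∧-right {f axt} (∧-right {f atx} p))))
everyOrder-sound f p xta = ∧-right {f xat} (∧-right {f txa} (∧-right {f tax} (∧-right {f axt} (∧-right {f atx} p))))

everyOrder²-sound : ∀ (f : RoleOrder → RoleOrder → Bool) → T (everyOrder λ o → everyOrder (f o)) → ∀ o o' → T (f o o')
everyOrder²-sound f p o = everyOrder-sound (f o) (everyOrder-sound (λ o → everyOrder (f o)) p o)

everyProfile3 : (Profile3 → Bool) → Bool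
everyProfile3 f = everyOrder λ o → everyOrder λ d → everyOrder λ l → f ⟪ o , d , l ⟫

everyProfile3-sound : ∀ (f : Profile3 → Bool) → T (everyProfile3 f) → ∀ r → T (f r)
everyProfile3-sound f p ⟪ o , d , l ⟫ =
  everyOrder-sound (λ l → f ⟪ o , d , l ⟫) (everyOrder²-sound (λ o d → everyOrder λ l → f ⟪ o , d , l ⟫) p o d) l

code : RoleOrder → ℕ
code atx = 0
code axt = 1
code tax = 2
code txa = 3
code xat = 4
code xta = 5

decode : ℕ → RoleOrder
decode 0 = atx
decode 1 = axt
decode 2 = tax
decode 3 = txa
decode 4 = xat
decode _ = xta

decode-code : ∀ o → decode (code o) ≡ o
decode-code atx = refl
decode-code axt = refl
decode-code tax = refl
decode-code txa = refl
decode-code xat = refl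
decode-code xta = refl

_==_ : RoleOrder → RoleOrder → Bool
o == o' = code o ≡ᵇ code o'

==-sound : ∀ {o o'} → T (o == o') → o ≡ o'
==-sound {o} {o'} p =
  trans (sym (decode-code o)) (trans (cong decode (≡ᵇ⇒≡ (code o) (code o') p)) (decode-code o'))

_is_ : Profile3 → Profile3 → Bool
⟪ o , d , l ⟫ is ⟪ o' , d' , l' ⟫ = (o == o') ∧ (d == d') ∧ (l == l')

is-sound : ∀ r r' → T (r is r') → r ≡ r'
is-sound ⟪ o , d , l ⟫ ⟪ o' , d' , l' ⟫ p
  with ==-sound {o} (∧-left p) | ==-sound {d} (∧-left (∧-right {o == o'} p))
     | ==-sound {l} (∧-right {d == d'} (∧-right {o == o'} p))
... | refl | refl | refl = refl

-- The finite core of the proof.  Starting from any valid three-voter profile, the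
-- following six attempted moves always end at the same profile, the hub.
hub : Profile3
hub = ⟪ txa , xat , tax ⟫

schedule : List Move
schedule = (blockSeat , tax) ∷ (dissenterSeat , xat) ∷ (allySeat , tax) ∷ (dissenterSeat , axt)
         ∷ (blockSeat , txa) ∷ (dissenterSeat , xat) ∷ []

reaches-hub : Profile3 → Bool
reaches-hub r = valid r ⇒ᵇ (run r schedule is hub)

opaque
  unfolding run

  reaches-hub-everywhere : T (everyProfile3 reaches-hub)
  reaches-hub-everywhere = tt

schedule-ends-at-hub : ∀ r → T (valid r) → run r schedule ≡ hub
schedule-ends-at-hub r v = is-sound (run r schedule) hub
  (modus {valid r} {run r schedule is hub} (everyProfile3-sound reaches-hub reaches-hub-everywhere r) v)

-- From the hub, forced moves lead to three further profiles.  Rereading the model with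
-- target and other exchanged (relabel3), and possibly with the two pair voters exchanged
-- (swapPair), turns these into one another: this is where two attained values meet.
crossed twin twin' : Profile3
crossed = ⟪ xta , xat , tax ⟫
twin    = ⟪ txa , axt , xta ⟫
twin'   = ⟪ xta , atx , txa ⟫

opaque
  unfolding run

  hub-to-crossed : run hub ((dissenterSeat , axt) ∷ (blockSeat , xta) ∷ (dissenterSeat , xat) ∷ []) ≡ crossed
  hub-to-crossed = refl

  crossed-to-twin' : run crossed ((dissenterSeat , atx) ∷ (allySeat , txa) ∷ []) ≡ twin'
  crossed-to-twin' = refl

  hub-to-twin : run hub ((blockSeat , tax) ∷ (allySeat , xta) ∷ (dissenterSeat , axt) ∷ (blockSeat , txa) ∷ []) ≡ twin
  hub-to-twin = refl

twins-meet : relabel3 twin ≡ twin'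
twins-meet = refl

crossings-meet : swapPair (relabel3 crossed) ≡ hub
crossings-meet = refl

split : RoleOrder → RoleOrder → Bool
split d l = (anchor ≻⟨ d ⟩ target) ∧ (target ≻⟨ l ⟩ anchor)

-- If a pair voter ranks other above target, the block may put the target on top, ranking
-- anchor and other in the order opposite to the dissenter.
crown : RoleOrder → RoleOrder
crown d = if anchor ≻⟨ d ⟩ other then txa else tax

crown-on-top : ∀ d → T ((target ≻⟨ crown d ⟩ anchor) ∧ (target ≻⟨ crown d ⟩ other))
crown-on-top d with anchor ≻⟨ d ⟩ other
... | true  = tt
... | false = tt

crown-np3 : ∀ d l → T (split d l) → T ((other ≻⟨ d ⟩ target) ∨ (other ≻⟨ l ⟩ target)) →
            T (np3 ⟪ crown d , d , l ⟫)
crown-np3 d l s o = modus {split d l ∧ ((other ≻⟨ d ⟩ target) ∨ (other ≻⟨ l ⟩ target))} {np3 ⟪ crown d , d , l ⟫}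
  (everyOrder²-sound claim checked d l) (∧-intro {split d l} s o)
  where
  claim : RoleOrder → RoleOrder → Bool
  claim d l = (split d l ∧ ((other ≻⟨ d ⟩ target) ∨ (other ≻⟨ l ⟩ target))) ⇒ᵇ np3 ⟪ crown d , d , l ⟫
  checked : T (everyOrder λ d → everyOrder (claim d))
  checked = tt

-- Otherwise the dissenter ranks anchor, target, other in this order, and some voter c
-- outside the pair ranks other, target, anchor; with the ally moved to tax, the profile
-- (c, d, tax) satisfies np3, and in it the anchor beats other for both pair voters.
lowered : RoleOrder → Bool
lowered d = (anchor ≻⟨ d ⟩ target) ∧ not (other ≻⟨ d ⟩ target)

witness : RoleOrder → Bool
witness c = (other ≻⟨ c ⟩ target) ∧ (target ≻⟨ c ⟩ anchor)

lowered-np3 : ∀ c d → T (witness c) → T (lowered d) → T (np3 ⟪ c , d , tax ⟫)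
lowered-np3 c d w s = modus {witness c ∧ lowered d} {np3 ⟪ c , d , tax ⟫}
  (everyOrder²-sound claim checked c d) (∧-intro {witness c} w s)
  where
  claim : RoleOrder → RoleOrder → Bool
  claim c d = (witness c ∧ lowered d) ⇒ᵇ np3 ⟪ c , d , tax ⟫
  checked : T (everyOrder λ c → everyOrder (claim c))
  checked = tt

lowered-excludes-other : ∀ d → T (lowered d) → T (excluded ⟪ xta , d , tax ⟫ other)
lowered-excludes-other d = modus {lowered d} {excluded ⟪ xta , d , tax ⟫ other} (everyOrder-sound claim checked d)
  where
  claim : RoleOrder → Bool
  claim d = lowered d ⇒ᵇ excluded ⟪ xta , d , tax ⟫ other
  checked : T (everyOrder claim)
  checked = tt

firstVoter : (n : ℕ) → 3 ≤ n → Fin n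
firstVoter (suc n) _ = zero

toℕ-firstVoter : ∀ n (h : 3 ≤ n) → toℕ (firstVoter n h) ≡ 0
toℕ-firstVoter (suc n) _ = refl

first≢penult : ∀ n (h : 3 ≤ n) → firstVoter n h ≢ indN-1 n h
first≢penult (suc (suc (suc m))) (s≤s (s≤s (s≤s _))) e =
  0≢1+n (trans (cong toℕ e) (toℕ-fromℕ< {suc m} (s<s (n≤1+n (suc m)))))

first≢last : ∀ n (h : 3 ≤ n) → firstVoter n h ≢ indN n h
first≢last (suc (suc (suc m))) (s≤s (s≤s (s≤s _))) e =
  0≢1+n (trans (cong toℕ e) (toℕ-fromℕ< {suc (suc m)} ≤-refl))

penult≢last : ∀ n (h : 3 ≤ n) → indN-1 n h ≢ indN n h
penult≢last (suc (suc k)) (s≤s (s≤s _)) e =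
  1+n≢n (sym (trans (sym (toℕ-fromℕ< {k} (s<s (n≤1+n k)))) (trans (cong toℕ e) (toℕ-fromℕ< {suc k} ≤-refl))))

data Side : Set where
  penultimate ultimate : Side

partner : Side → Side
partner penultimate = ultimate
partner ultimate    = penultimate

partner-involutive : ∀ side → partner (partner side) ≡ side
partner-involutive penultimate = refl
partner-involutive ultimate    = refl

side-or-partner : ∀ side s → s ≡ side ⊎ s ≡ partner side
side-or-partner penultimate penultimate = inj₁ refl
side-or-partner penultimate ultimate    = inj₂ refl
side-or-partner ultimate    penultimate = inj₂ refl
side-or-partner ultimate    ultimate    = inj₁ refl

module Analysis (n : ℕ) (h : 3 ≤ n) (g : Rule n) (sp : StrategyProof g) (a : X)
  (anchored : ∀ u (hu : NP* n h u) → g u (proj₁ hu) ≡ a) where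

  penult last first : Fin n
  penult = indN-1 n h
  last   = indN n h
  first  = firstVoter n h

  pairVoter : Side → Fin n
  pairVoter penultimate = penult
  pairVoter ultimate    = last

  pair-distinct : ∀ side → pairVoter side ≢ pairVoter (partner side)
  pair-distinct penultimate = penult≢last n h
  pair-distinct ultimate    = ≢-sym (penult≢last n h)

  first-outside : ∀ side → first ≢ pairVoter side
  first-outside penultimate = first≢penult n h
  first-outside ultimate    = first≢last n h

  Outsider : Fin n → Set
  Outsider i = i ≢ penult × i ≢ last

  locate : ∀ side i → i ≡ pairVoter side ⊎ i ≡ pairVoter (partner side)
                     ⊎ (i ≢ pairVoter side × i ≢ pairVoter (partner side))
  locate side i with i ≟ pairVoter side | i ≟ pairVoter (partner side)
  ... | yes e   | _      = inj₁ e
  ... | no _    | yes e  = inj₂ (inj₁ e)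
  ... | no ne₁  | no ne₂ = inj₂ (inj₂ (ne₁ , ne₂))

  _[_≔_] : Profile n → Fin n → LinOrd → Profile n
  (p [ j ≔ R ]) i with i ≟ j
  ... | yes _ = R
  ... | no _ = p i

  update-here : ∀ p j R → (p [ j ≔ R ]) j ≡ R
  update-here p j R with j ≟ j
  ... | yes _ = refl
  ... | no j≢j = ⊥-elim (j≢j refl)

  update-elsewhere : ∀ p {j} R i → i ≢ j → (p [ j ≔ R ]) i ≡ p i
  update-elsewhere p {j} R i i≢j with i ≟ j
  ... | yes i≡j = ⊥-elim (i≢j i≡j)
  ... | no _ = refl

  update-variant : ∀ p j R → Variant j p (p [ j ≔ R ])
  update-variant p j R i i≢j = update-elsewhere p R i i≢j

  stable : ∀ i {p q} (np : NP p) (nq : NP q) → Variant i p q →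
           ¬ g q nq ≻[ p i ] g p np × ¬ g p np ≻[ q i ] g q nq
  stable i {p} {q} np nq v = sp i p q np nq v , sp i q p nq np (λ j j≢i → sym (v j j≢i))

  unmoved : ∀ i {p q} (np : NP p) (nq : NP q) → Variant i p q → Agrees (p i) (q i) → g p np ≡ g q nq
  unmoved i {p} np nq v agree with stable i np nq v
  ... | forward , backward = indifferent (p i) (λ p≻q → backward (agree _ _ p≻q)) forward

  np-agree : ∀ {p q : Profile n} → (∀ i → Agrees (p i) (q i)) → NP p → NP q
  np-agree agree np x y x≢y with np x y x≢y
  ... | i , j , x≻y , y≻x = i , j , agree i x y x≻y , agree j y x y≻x

  np-reversed : ∀ (q : Profile n) {i j} → q j ≡ reverse (q i) → NP q
  np-reversed q {i} {j} reversed x y x≢y with prefer-total (q i) x≢y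
  ... | inj₁ x≻y = i , j , x≻y , subst (λ R → y ≻[ R ] x) (sym reversed) (reverse-flips (q i) x≻y)
  ... | inj₂ y≻x = j , i , subst (λ R → x ≻[ R ] y) (sym reversed) (reverse-flips (q i) y≻x) , y≻x

  -- Lemma A: no voter outside the pair ranks the anchor above the outcome.  Move n - 1 and
  -- then n to the reversal ρ of p i: the result lies in NP*, so has outcome a, and the two
  -- moves give g p ≽ s₁ ≽ a in p i, where s₁ is the intermediate outcome.
  outsiders-accept : ∀ p np i → Outsider i → ¬ a ≻[ p i ] g p np
  outsiders-accept p np i (i≢penult , i≢last) a≻s = s₁≽a a≻s₁
    where
    ρ  = reverse (p i)
    p₁ = p [ penult ≔ ρ ]
    u  = p₁ [ last ≔ ρ ]
    p₁-i : p₁ i ≡ p i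
    p₁-i = update-elsewhere p ρ i i≢penult
    u-penult : u penult ≡ ρ
    u-penult = trans (update-elsewhere p₁ ρ penult (penult≢last n h)) (update-here p penult ρ)
    np₁ : NP p₁
    np₁ = np-reversed p₁ {i} {penult} (trans (update-here p penult ρ) (cong reverse (sym p₁-i)))
    nu : NP u
    nu = np-reversed u {i} {penult} (trans u-penult (cong reverse (sym (trans (update-elsewhere p₁ ρ i i≢last) p₁-i))))
    g-u : g u nu ≡ a
    g-u = anchored u (nu , trans u-penult (sym (update-here p₁ last ρ)))
    s₁ = g p₁ np₁
    -- the last voter, holding ρ at u, does not prefer s₁ to a
    s₁≽a : ¬ a ≻[ p i ] s₁
    s₁≽a a≻s₁ = proj₂ (stable last np₁ nu (update-variant p₁ last ρ))
                  (subst₂ (λ R v → s₁ ≻[ R ] v) (sym (update-here p₁ last ρ)) (sym g-u) (reverse-flips (p i) a≻s₁))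
    -- the penultimate voter, holding ρ at p₁, does not prefer g p to s₁
    a≻s₁ : a ≻[ p i ] s₁
    a≻s₁ = ≻-≽-trans (p i) a≻s λ s₁≻s → proj₂ (stable penult np np₁ (update-variant p penult ρ))
             (subst (λ R → g p np ≻[ R ] s₁) (sym (update-here p penult ρ)) (reverse-flips (p i) s₁≻s))

  -- Moving first the partner and then the given pair voter to the reversal of the first
  -- voter's order reaches NP*.
  detour : ∀ side p np → Σ X λ s₁ → ¬ a ≻[ p (pairVoter side) ] s₁ × ¬ s₁ ≻[ p (pairVoter (partner side)) ] g p np
  detour side p np = g p' np' , forward-j , proj₁ (stable k np np' (update-variant p k ρ))
    where
    j = pairVoter side
    k = pairVoter (partner side)
    ρ  = reverse (p first)
    p' = p [ k ≔ ρ ]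
    u  = p' [ j ≔ ρ ]
    p'-first : p' first ≡ p first
    p'-first = update-elsewhere p ρ first (first-outside (partner side))
    np' : NP p'
    np' = np-reversed p' {first} {k} (trans (update-here p k ρ) (cong reverse (sym p'-first)))
    u-first : u first ≡ p first
    u-first = trans (update-elsewhere p' ρ first (first-outside side)) p'-first
    u-pair : ∀ s → u (pairVoter s) ≡ ρ
    u-pair s with side-or-partner side s
    ... | inj₁ refl = update-here p' j ρ
    ... | inj₂ refl = trans (update-elsewhere p' ρ k (≢-sym (pair-distinct side))) (update-here p k ρ)
    nu : NP u
    nu = np-reversed u {first} {j} (trans (u-pair side) (cong reverse (sym u-first)))
    g-u : g u nu ≡ a
    g-u = anchored u (nu , trans (u-pair penultimate) (sym (u-pair ultimate)))
    forward-j : ¬ a ≻[ p j ] g p' np'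
    forward-j a≻s₁ = proj₁ (stable j np' nu (update-variant p' j ρ))
      (subst₂ (λ R v → v ≻[ R ] g p' np') (sym (update-elsewhere p ρ j (pair-distinct side))) (sym g-u) a≻s₁)

  -- Lemma E: the two pair voters do not both rank the anchor above the outcome s.  Otherwise
  -- the detours on both sides lead to alternatives s₁, s₂ distinct from a and s, hence equal,
  -- while n - 1 ranks s₁ above s but not s₂.
  pair-not-both : ∀ p np → a ≻[ p penult ] g p np → ¬ a ≻[ p last ] g p np
  pair-not-both p np a≻₁s a≻₂s = s₂⊁s (subst (λ v → v ≻[ R₁ ] s) s₁≡s₂ s₁≻s)
    where
    R₁ = p penult
    R₂ = p last
    s  = g p np
    route₁ = detour penultimate p np
    route₂ = detour ultimate p np
    s₁ = proj₁ route₁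
    s₂ = proj₁ route₂
    s₂⊁s : ¬ s₂ ≻[ R₁ ] s
    s₂⊁s = proj₂ (proj₂ route₂)
    s₁≻s : s₁ ≻[ R₁ ] s
    s₁≻s = ≽-≻-trans R₁ (proj₁ (proj₂ route₁)) a≻₁s
    s₂≻s : s₂ ≻[ R₂ ] s
    s₂≻s = ≽-≻-trans R₂ (proj₁ (proj₂ route₂)) a≻₂s
    a≢s : a ≢ s
    a≢s a≡s = prefer-irrefl R₁ (subst (λ v → a ≻[ R₁ ] v) (sym a≡s) a≻₁s)
    s₁≢a : s₁ ≢ a
    s₁≢a s₁≡a = proj₂ (proj₂ route₁) (subst (λ v → v ≻[ R₂ ] s) (sym s₁≡a) a≻₂s)
    s₁≢s : s₁ ≢ s
    s₁≢s s₁≡s = prefer-irrefl R₁ (subst (λ v → s₁ ≻[ R₁ ] v) (sym s₁≡s) s₁≻s)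
    s₂≢a : s₂ ≢ a
    s₂≢a s₂≡a = s₂⊁s (subst (λ v → v ≻[ R₁ ] s) (sym s₂≡a) a≻₁s)
    s₂≢s : s₂ ≢ s
    s₂≢s s₂≡s = prefer-irrefl R₂ (subst (λ v → s₂ ≻[ R₂ ] v) (sym s₂≡s) s₂≻s)
    s₁≡s₂ : s₁ ≡ s₂
    s₁≡s₂ = trans (third-unique a≢s s₁≢a s₁≢s) (sym (third-unique a≢s s₂≢a s₂≢s))

  pair-once : ∀ side p np → a ≻[ p (pairVoter side) ] g p np → ¬ a ≻[ p (pairVoter (partner side)) ] g p np
  pair-once penultimate p np a≻s a≻'s = pair-not-both p np a≻s a≻'s
  pair-once ultimate    p np a≻s a≻'s = pair-not-both p np a≻'s a≻s

  Excluded : Profile n → X → Set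
  Excluded q s = (Σ (Fin n) λ i → Outsider i × a ≻[ q i ] s) ⊎ (a ≻[ q penult ] s × a ≻[ q last ] s)

  never-excluded : ∀ q nq → ¬ Excluded q (g q nq)
  never-excluded q nq (inj₁ (i , outside , a≻s)) = outsiders-accept q nq i outside a≻s
  never-excluded q nq (inj₂ (a≻₁s , a≻₂s))       = pair-not-both q nq a≻₁s a≻₂s

  excluded-by-pair : ∀ side q s → a ≻[ q (pairVoter side) ] s → a ≻[ q (pairVoter (partner side)) ] s → Excluded q s
  excluded-by-pair penultimate q s a≻s a≻'s = inj₂ (a≻s , a≻'s)
  excluded-by-pair ultimate    q s a≻s a≻'s = inj₂ (a≻'s , a≻s)

  -- Equal profiles have equal outcomes (the membership proof is irrelevant, the profile is
  -- only determined pointwise).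
  same-profile : ∀ {p q : Profile n} np nq → (∀ i → p i ≡ q i) → g p np ≡ g q nq
  same-profile np nq e = unmoved first np nq (λ i _ → sym (e i)) (agrees-≡ (e first))

  splice : ℕ → Profile n → Profile n → Profile n
  splice k p q i with toℕ i <? k
  ... | yes _ = q i
  ... | no _  = p i

  splice-before : ∀ {k} p q i → toℕ i < k → splice k p q i ≡ q i
  splice-before {k} p q i i<k with toℕ i <? k
  ... | yes _ = refl
  ... | no i≮k = ⊥-elim (i≮k i<k)

  splice-after : ∀ {k} p q i → ¬ toℕ i < k → splice k p q i ≡ p i
  splice-after {k} p q i i≮k with toℕ i <? k
  ... | yes i<k = ⊥-elim (i≮k i<k)
  ... | no _ = refl

  splice-either : ∀ k p q i → splice k p q i ≡ p i ⊎ splice k p q i ≡ q i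
  splice-either k p q i with toℕ i <? k
  ... | yes _ = inj₂ refl
  ... | no _  = inj₁ refl

  splice-step : ∀ {k} p q (lt : k < n) → Variant (fromℕ< lt) (splice k p q) (splice (suc k) p q)
  splice-step {k} p q lt i i≢k with toℕ i <? k
  ... | yes i<k = splice-before p q i (m<n⇒m<1+n i<k)
  ... | no i≮k  = splice-after p q i i≮1+k
    where
    i≮1+k : ¬ toℕ i < suc k
    i≮1+k i<1+k with m<1+n⇒m<n∨m≡n i<1+k
    ... | inj₁ i<k = i≮k i<k
    ... | inj₂ i≡k = i≢k (toℕ-injective (trans i≡k (sym (toℕ-fromℕ< lt))))

  chain : ∀ (p q : Profile n) (Inv : X → Set) (nps : ∀ k → NP (splice k p q)) →
    (∀ k (lt : k < n) → Inv (g (splice k p q) (nps k))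
       → ¬ g (splice (suc k) p q) (nps (suc k)) ≻[ p (fromℕ< lt) ] g (splice k p q) (nps k)
       → ¬ g (splice k p q) (nps k) ≻[ q (fromℕ< lt) ] g (splice (suc k) p q) (nps (suc k))
       → Inv (g (splice (suc k) p q) (nps (suc k)))) →
    ∀ np nq → Inv (g p np) → Inv (g q nq)
  chain p q Inv nps step np nq at-p =
    subst Inv (same-profile (nps n) nq (λ i → splice-before {n} p q i (toℕ<n i))) (reach n ≤-refl)
    where
    reach : ∀ k → k ≤ n → Inv (g (splice k p q) (nps k))
    reach zero _ = subst Inv (same-profile np (nps 0) (λ i → sym (splice-after {0} p q i λ ()))) at-p
    reach (suc k) k<n = step k k<n (reach k (<⇒≤ k<n)) forward backward
      where
      i = fromℕ< k<n
      moves = stable i (nps k) (nps (suc k)) (splice-step p q k<n)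
      forward = subst (λ R → ¬ g (splice (suc k) p q) (nps (suc k)) ≻[ R ] g (splice k p q) (nps k))
                  (splice-after {k} p q i (λ i<k → ℕₚ.<-irrefl (toℕ-fromℕ< k<n) i<k)) (proj₁ moves)
      backward = subst (λ R → ¬ g (splice k p q) (nps k) ≻[ R ] g (splice (suc k) p q) (nps (suc k)))
                   (splice-before {suc k} p q i (subst (_< suc k) (sym (toℕ-fromℕ< k<n)) (n<1+n k))) (proj₂ moves)

  agreeing-profiles : ∀ {p q : Profile n} np nq → (∀ i → Agrees (p i) (q i)) → g p np ≡ g q nq
  agreeing-profiles {p} {q} np nq agree = sym (chain p q (_≡ g p np) nps step np nq refl)
    where
    nps : ∀ k → NP (splice k p q)
    nps k = np-agree {p} {splice k p q} agree-splice np
      where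
      agree-splice : ∀ i → Agrees (p i) (splice k p q i)
      agree-splice i with splice-either k p q i
      ... | inj₁ e = agrees-≡ (sym e)
      ... | inj₂ e = subst (Agrees (p i)) (sym e) (agree i)
    step : ∀ k (lt : k < n) → g (splice k p q) (nps k) ≡ g p np
       → ¬ g (splice (suc k) p q) (nps (suc k)) ≻[ p (fromℕ< lt) ] g (splice k p q) (nps k)
       → ¬ g (splice k p q) (nps k) ≻[ q (fromℕ< lt) ] g (splice (suc k) p q) (nps (suc k))
       → g (splice (suc k) p q) (nps (suc k)) ≡ g p np
    step k lt old≡ forward backward =
      trans (indifferent (p (fromℕ< lt)) forward (λ old≻new → backward (agree _ _ _ old≻new))) old≡

  -- Seating the n voters in the finite model: the pair voter on the given side takes the
  -- dissenter's seat, its partner the ally's, everybody else the block.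
  seatOf : Side → Fin n → Seat
  seatOf side i with i ≟ pairVoter side | i ≟ pairVoter (partner side)
  ... | yes _ | _     = dissenterSeat
  ... | no _  | yes _ = allySeat
  ... | no _  | no _  = blockSeat

  -- The voter occupying each seat: the first voter represents the block.
  seatVoter : Side → Seat → Fin n
  seatVoter side blockSeat     = first
  seatVoter side dissenterSeat = pairVoter side
  seatVoter side allySeat      = pairVoter (partner side)

  seatOf-seatVoter : ∀ side v → seatOf side (seatVoter side v) ≡ v
  seatOf-seatVoter side blockSeat with first ≟ pairVoter side | first ≟ pairVoter (partner side)
  ... | yes e | _     = ⊥-elim (first-outside side e)
  ... | no _  | yes e = ⊥-elim (first-outside (partner side) e)
  ... | no _  | no _  = refl
  seatOf-seatVoter side dissenterSeat with pairVoter side ≟ pairVoter side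
  ... | yes _ = refl
  ... | no ne = ⊥-elim (ne refl)
  seatOf-seatVoter side allySeat with pairVoter (partner side) ≟ pairVoter side | pairVoter (partner side) ≟ pairVoter (partner side)
  ... | yes e | _     = ⊥-elim (pair-distinct side (sym e))
  ... | no _  | yes _ = refl
  ... | no _  | no ne = ⊥-elim (ne refl)

  seatOf-pair : ∀ side i → seatOf side i ≢ blockSeat → i ≡ seatVoter side (seatOf side i)
  seatOf-pair side i off with i ≟ pairVoter side | i ≟ pairVoter (partner side)
  ... | yes e | _     = e
  ... | no _  | yes e = e
  ... | no _  | no _  = ⊥-elim (off refl)

  seatOf-outside : ∀ side i → i ≢ pairVoter side → i ≢ pairVoter (partner side) → seatOf side i ≡ blockSeat
  seatOf-outside side i ne₁ ne₂ with i ≟ pairVoter side | i ≟ pairVoter (partner side)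
  ... | yes e | _     = ⊥-elim (ne₁ e)
  ... | no _  | yes e = ⊥-elim (ne₂ e)
  ... | no _  | no _  = refl

  first-outsider : Outsider first
  first-outsider = first-outside penultimate , first-outside ultimate

  toℕ-first : toℕ first ≡ 0
  toℕ-first = toℕ-firstVoter n h

  -- A frame: an attained value t ≠ a identifies a, t and third a t with the roles anchor,
  -- target and other, and role orders with linear orders on X.
  module Frame (t : X) (t≢a : t ≢ a) where

    a≢t : a ≢ t
    a≢t = ≢-sym t≢a

    σ : Role → X
    σ anchor = a
    σ target = t
    σ other  = third a t

    roleOf : X → Role
    roleOf y with y ≟ a
    ... | yes _ = anchor
    ... | no _ with y ≟ t
    ...   | yes _ = target
    ...   | no _  = other

    σ-roleOf : ∀ y → σ (roleOf y) ≡ y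
    σ-roleOf y with y ≟ a
    ... | yes y≡a = sym y≡a
    ... | no y≢a with y ≟ t
    ...   | yes y≡t = sym y≡t
    ...   | no y≢t  = sym (third-unique a≢t y≢a y≢t)

    roleOf-σ : ∀ ρ → roleOf (σ ρ) ≡ ρ
    roleOf-σ anchor with a ≟ a
    ... | yes _ = refl
    ... | no a≢a = ⊥-elim (a≢a refl)
    roleOf-σ target with t ≟ a
    ... | yes t≡a = ⊥-elim (t≢a t≡a)
    ... | no _ with t ≟ t
    ...   | yes _ = refl
    ...   | no t≢t = ⊥-elim (t≢t refl)
    roleOf-σ other with third a t ≟ a
    ... | yes x≡a = ⊥-elim (proj₁ (third-fresh a≢t) x≡a)
    ... | no _ with third a t ≟ t
    ...   | yes x≡t = ⊥-elim (proj₂ (third-fresh a≢t) x≡t)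
    ...   | no _ = refl

    is-target : ∀ s → (∀ ρ → ρ ≢ target → σ ρ ≡ s → ⊥) → s ≡ t
    is-target s refute with roleOf s in role
    ... | target = trans (sym (σ-roleOf s)) (cong σ role)
    ... | anchor = ⊥-elim (refute anchor (λ ()) (trans (cong σ (sym role)) (σ-roleOf s)))
    ... | other  = ⊥-elim (refute other (λ ()) (trans (cong σ (sym role)) (σ-roleOf s)))

    interp : RoleOrder → LinOrd
    interp o = record
      { rank = λ y → position o (roleOf y)
      ; rank-inj = λ {y} {z} e → trans (sym (σ-roleOf y)) (trans (cong σ (position-injective o e)) (σ-roleOf z)) }

    record Represents (R : LinOrd) (o : RoleOrder) : Set where
      constructor represents
      field placed : ∀ ρ → rank R (σ ρ) ≡ position o ρ
    open Represents

    interp-represents : ∀ o → Represents (interp o) o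
    interp-represents o = represents λ ρ → cong (position o) (roleOf-σ ρ)

    classify : LinOrd → RoleOrder
    classify R = fromPositions (rank R a) (rank R t)

    classify-represents : ∀ R → Represents R (classify R)
    classify-represents R = represents placement
      where
      spec = fromPositions-spec (λ e → a≢t (rank-inj R e))
      placement : ∀ ρ → rank R (σ ρ) ≡ position (classify R) ρ
      placement anchor = sym (proj₁ spec)
      placement target = sym (proj₁ (proj₂ spec))
      placement other  = trans
        (third-unique (λ e → a≢t (rank-inj R e)) (λ e → proj₁ (third-fresh a≢t) (rank-inj R e))
                                                 (λ e → proj₂ (third-fresh a≢t) (rank-inj R e)))
        (sym (proj₂ (proj₂ spec)))

    reads : ∀ {R o} → Represents R o → ∀ {ρ ρ'} → T (ρ ≻⟨ o ⟩ ρ') → σ ρ ≻[ R ] σ ρ'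
    reads {R} {o} rep {ρ} {ρ'} p =
      subst₂ (λ i j → toℕ i < toℕ j) (sym (placed rep ρ)) (sym (placed rep ρ')) (<ᵇ⇒< _ _ p)

    reads⁻ : ∀ {R o} → Represents R o → ∀ {ρ ρ'} → σ ρ ≻[ R ] σ ρ' → T (ρ ≻⟨ o ⟩ ρ')
    reads⁻ {R} {o} rep {ρ} {ρ'} p = <⇒<ᵇ (subst₂ (λ i j → toℕ i < toℕ j) (placed rep ρ) (placed rep ρ') p)

    same-code-agrees : ∀ {R R' o} → Represents R o → Represents R' o → Agrees R R'
    same-code-agrees {R} {R'} rep rep' y z y≻z =
      subst₂ (λ u v → u ≻[ R' ] v) (σ-roleOf y) (σ-roleOf z)
        (reads rep' {roleOf y} {roleOf z} (reads⁻ rep (subst₂ (λ u v → u ≻[ R ] v) (sym (σ-roleOf y)) (sym (σ-roleOf z)) y≻z)))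

    embed : Side → Profile3 → Profile n
    embed side r i = interp (seat r (seatOf side i))

    -- Each seat of r is represented by some voter of q; this is all NP needs.
    Witnessed : Profile n → Profile3 → Set
    Witnessed q r = ∀ v → Σ (Fin n) λ i → Represents (q i) (seat r v)

    -- The seat voters of q represent the seats of r; this also transfers exclusions.
    Hosts : Side → Profile n → Profile3 → Set
    Hosts side q r = ∀ v → Represents (q (seatVoter side v)) (seat r v)

    embed-hosts : ∀ side r → Hosts side (embed side r) r
    embed-hosts side r v =
      subst (λ w → Represents (interp (seat r w)) (seat r v)) (sym (seatOf-seatVoter side v)) (interp-represents (seat r v))

    witnessed-pref : ∀ q r → Witnessed q r → T (np3 r) → ∀ y z → y ≢ z → Σ (Fin n) λ i → y ≻[ q i ] z
    witnessed-pref q r wit np3-r y z y≢z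
      with someone-seat r (np3-pair r {roleOf y} {roleOf z} np3-r λ e → y≢z (trans (sym (σ-roleOf y)) (trans (cong σ e) (σ-roleOf z))))
    ... | v , pref = proj₁ (wit v) ,
      subst₂ (λ u w → u ≻[ q (proj₁ (wit v)) ] w) (σ-roleOf y) (σ-roleOf z) (reads (proj₂ (wit v)) pref)

    np-witnessed : ∀ q r → Witnessed q r → T (np3 r) → NP q
    np-witnessed q r wit np3-r y z y≢z
      with witnessed-pref q r wit np3-r y z y≢z | witnessed-pref q r wit np3-r z y (≢-sym y≢z)
    ... | i , y≻z | j , z≻y = i , j , y≻z , z≻y

    np-hosted : ∀ side q r → Hosts side q r → T (np3 r) → NP q
    np-hosted side q r hosts = np-witnessed q r λ v → seatVoter side v , hosts v

    excluded-hosted : ∀ side q r → Hosts side q r → ∀ ρ → T (excluded r ρ) → Excluded q (σ ρ)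
    excluded-hosted side q r hosts ρ e with excluded-cases r ρ e
    ... | inj₁ block-rejects = inj₁ (first , first-outsider , reads (hosts blockSeat) block-rejects)
    ... | inj₂ (d-rejects , l-rejects) =
      excluded-by-pair side q (σ ρ) (reads (hosts dissenterSeat) d-rejects) (reads (hosts allySeat) l-rejects)

    Attained : Side → Profile3 → Set
    Attained side r = Σ (NP (embed side r)) λ np → g (embed side r) np ≡ t

    settle : ∀ side {q : Profile n} (nq : NP q) r {R R' o} → Hosts side q r → Represents R' o →
      ¬ g q nq ≻[ R ] t → ¬ t ≻[ R' ] g q nq →
      (∀ ρ → ρ ≢ target → σ ρ ≻[ R ] t ⊎ T ((target ≻⟨ o ⟩ ρ) ∨ excluded r ρ)) → g q nq ≡ t
    settle side {q} nq r {R} {R'} {o} hosts rep forward backward rules = is-target (g q nq) refute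
      where
      refute : ∀ ρ → ρ ≢ target → σ ρ ≡ g q nq → ⊥
      refute ρ ρ≢target σρ≡s with rules ρ ρ≢target
      ... | inj₁ old-prefers = forward (subst (λ s → s ≻[ R ] t) σρ≡s old-prefers)
      ... | inj₂ rest with ∨-elim {target ≻⟨ o ⟩ ρ} rest
      ...   | inj₁ new-below = backward (subst (λ s → t ≻[ R' ] s) σρ≡s (reads rep new-below))
      ...   | inj₂ excl = never-excluded q nq (subst (Excluded q) σρ≡s (excluded-hosted side q r hosts ρ excl))

    PairFits : Side → Profile n → Profile3 → Set
    PairFits side p r = ∀ v → v ≢ blockSeat → Represents (p (seatVoter side v)) (seat r v)

    pair-fits : ∀ {side p o d l} → Represents (p (pairVoter side)) d → Represents (p (pairVoter (partner side))) l →
                PairFits side p ⟪ o , d , l ⟫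
    pair-fits rep-d rep-l blockSeat     off = ⊥-elim (off refl)
    pair-fits rep-d rep-l dissenterSeat _   = rep-d
    pair-fits rep-d rep-l allySeat      _   = rep-l

    Secure : Side → Profile n → Profile3 → Set
    Secure side p r = ∀ ρ → ρ ≢ target →
      (∀ i → seatOf side i ≡ blockSeat → σ ρ ≻[ p i ] t) ⊎ T ((target ≻⟨ block r ⟩ ρ) ∨ excluded r ρ)

    -- Once the first voter has moved, every splice from p to the realisation of r hosts r:
    -- the first voter holds the block order, and each pair voter an order described by its
    -- seat, whether it has moved or not.
    splice-pair : ∀ side p r → PairFits side p r → ∀ k v → v ≢ blockSeat →
                  Represents (splice k p (embed side r) (seatVoter side v)) (seat r v)
    splice-pair side p r fits k v off with splice-either k p (embed side r) (seatVoter side v)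
    ... | inj₁ e = subst (λ R → Represents R (seat r v)) (sym e) (fits v off)
    ... | inj₂ e = subst (λ R → Represents R (seat r v)) (sym e) (embed-hosts side r v)

    splice-hosts : ∀ side p r → PairFits side p r → ∀ k → Hosts side (splice (suc k) p (embed side r)) r
    splice-hosts side p r fits k blockSeat =
      subst (λ R → Represents R (block r)) (sym (splice-before p (embed side r) first (subst (_< suc k) (sym toℕ-first) z<s)))
        (embed-hosts side r blockSeat)
    splice-hosts side p r fits k dissenterSeat = splice-pair side p r fits (suc k) dissenterSeat (λ ())
    splice-hosts side p r fits k allySeat      = splice-pair side p r fits (suc k) allySeat (λ ())

    pair-keeps : ∀ side p r → PairFits side p r → ∀ i v → v ≢ blockSeat → seatOf side i ≡ v →
                 Agrees (p i) (interp (seat r v))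
    pair-keeps side p r fits i v off seat-i = same-code-agrees p-i (interp-represents (seat r v))
      where
      p-i : Represents (p i) (seat r v)
      p-i = subst (λ j → Represents (p j) (seat r v))
              (sym (trans (seatOf-pair side i (λ e → off (trans (sym seat-i) e))) (cong (seatVoter side) seat-i)))
              (fits v off)

    voter-moves : ∀ side p r → PairFits side p r → Secure side p r → ∀ i {q : Profile n} (nq : NP q) →
      Hosts side q r → ¬ g q nq ≻[ p i ] t → ¬ t ≻[ embed side r i ] g q nq → g q nq ≡ t
    voter-moves side p r fits secure i {q} nq hosts forward backward with seatOf side i in seat-i
    ... | blockSeat = settle side nq r {p i} {interp (block r)} hosts (interp-represents (block r)) forward backward rules
      where
      rules : ∀ ρ → ρ ≢ target → σ ρ ≻[ p i ] t ⊎ T ((target ≻⟨ block r ⟩ ρ) ∨ excluded r ρ)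
      rules ρ ρ≢target with secure ρ ρ≢target
      ... | inj₁ all-prefer = inj₁ (all-prefer i seat-i)
      ... | inj₂ rest       = inj₂ rest
    ... | dissenterSeat =
      indifferent (p i) forward (λ t≻s → backward (pair-keeps side p r fits i dissenterSeat (λ ()) seat-i _ _ t≻s))
    ... | allySeat =
      indifferent (p i) forward (λ t≻s → backward (pair-keeps side p r fits i allySeat (λ ()) seat-i _ _ t≻s))

    -- The transport lemma: moving the voters outside the pair, one at a time, to the block
    -- order of r keeps the outcome t, if the pair fits r, r satisfies np3 and p is secure.
    transport : ∀ side p (np : NP p) → g p np ≡ t → ∀ r → PairFits side p r → T (np3 r) → Secure side p r → Attained side r
    transport side p np g≡t r fits np3-r secure = nq , chain p q (_≡ t) nps step np nq g≡t
      where
      q = embed side r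
      nq = np-hosted side q r (embed-hosts side r) np3-r
      nps : ∀ k → NP (splice k p q)
      nps zero    = np-agree {p} {splice 0 p q} (λ i → agrees-≡ (sym (splice-after {0} p q i λ ()))) np
      nps (suc k) = np-hosted side (splice (suc k) p q) r (splice-hosts side p r fits k) np3-r
      step : ∀ k (lt : k < n) → g (splice k p q) (nps k) ≡ t
        → ¬ g (splice (suc k) p q) (nps (suc k)) ≻[ p (fromℕ< lt) ] g (splice k p q) (nps k)
        → ¬ g (splice k p q) (nps k) ≻[ q (fromℕ< lt) ] g (splice (suc k) p q) (nps (suc k))
        → g (splice (suc k) p q) (nps (suc k)) ≡ t
      step k lt old≡t forward backward = voter-moves side p r fits secure (fromℕ< lt) (nps (suc k)) (splice-hosts side p r fits k)
        (subst (λ s → ¬ g (splice (suc k) p q) (nps (suc k)) ≻[ p (fromℕ< lt) ] s) old≡t forward)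
        (subst (λ s → ¬ s ≻[ q (fromℕ< lt) ] g (splice (suc k) p q) (nps (suc k))) old≡t backward)

    pair-move : ∀ side r v o → v ≢ blockSeat → T (forces r v o) → Attained side r → Attained side (reseat r v o)
    pair-move side r v o off forced (np , g≡t) = np' ,
      settle side {embed side r'} np' r' {embed side r i} {interp o} (embed-hosts side r') (interp-represents o)
        (subst (λ s → ¬ g (embed side r') np' ≻[ embed side r i ] s) g≡t (proj₁ moves))
        (subst₂ (λ R s → ¬ s ≻[ R ] g (embed side r') np') new-order g≡t (proj₂ moves))
        rules
      where
      r' = reseat r v o
      i  = seatVoter side v
      np' = np-hosted side (embed side r') r' (embed-hosts side r') (∧-left forced)
      unchanged : Variant i (embed side r) (embed side r')
      unchanged j j≢i = cong interp (reseat-elsewhere r o λ e →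
        j≢i (trans (seatOf-pair side j (λ e' → off (trans (sym e) e'))) (cong (seatVoter side) e)))
      moves = stable i np np' unchanged
      new-order : embed side r' i ≡ interp o
      new-order = cong interp (trans (cong (seat r') (seatOf-seatVoter side v)) (reseat-here r v o))
      old-order : embed side r i ≡ interp (seat r v)
      old-order = cong (λ w → interp (seat r w)) (seatOf-seatVoter side v)
      rules : ∀ ρ → ρ ≢ target → σ ρ ≻[ embed side r i ] t ⊎ T ((target ≻⟨ o ⟩ ρ) ∨ excluded r' ρ)
      rules ρ ρ≢target with ∨-elim {ρ ≻⟨ seat r v ⟩ target} (rulesOut-from-forces r v o forced ρ≢target)
      ... | inj₁ old-prefers = inj₁ (subst (λ R → σ ρ ≻[ R ] t) (sym old-order) (reads (interp-represents (seat r v)) old-prefers))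
      ... | inj₂ rest = inj₂ rest

    -- A forced move of the block keeps the outcome t: the voters outside the pair move
    -- one at a time.
    block-move : ∀ side r o → T (forces r blockSeat o) → Attained side r → Attained side (reseat r blockSeat o)
    block-move side r@(⟪ o₀ , d , l ⟫) o forced (np , g≡t) =
      transport side (embed side r) np g≡t ⟪ o , d , l ⟫
        (pair-fits {side} {embed side r} (embed-hosts side r dissenterSeat) (embed-hosts side r allySeat)) (∧-left forced) secure
      where
      secure : Secure side (embed side r) ⟪ o , d , l ⟫
      secure ρ ρ≢target with ∨-elim {ρ ≻⟨ o₀ ⟩ target} (rulesOut-from-forces r blockSeat o forced ρ≢target)
      ... | inj₁ old-prefers = inj₁ λ i block-i →
              subst (λ w → σ ρ ≻[ interp (seat r w) ] t) (sym block-i) (reads (interp-represents o₀) old-prefers)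
      ... | inj₂ rest = inj₂ rest

    attempt-sound : ∀ side r m → Attained side r → Attained side (attempt r m)
    attempt-sound side r (v , o) att with forces r v o in forced
    ... | false = att
    ... | true with v
    ...   | blockSeat     = block-move side r o (subst T (sym forced) tt) att
    ...   | dissenterSeat = pair-move side r dissenterSeat o (λ ()) (subst T (sym forced) tt) att
    ...   | allySeat      = pair-move side r allySeat o (λ ()) (subst T (sym forced) tt) att

    run-sound : ∀ side r ms → Attained side r → Attained side (run r ms)
    run-sound side r [] att = subst (Attained side) (sym (run-nil r)) att
    run-sound side r (m ∷ ms) att =
      subst (Attained side) (sym (run-cons r m ms)) (run-sound side (attempt r m) ms (attempt-sound side r m att))

    along : ∀ side {r r'} ms → run r ms ≡ r' → Attained side r → Attained side r'
    along side {r} ms e att = subst (Attained side) e (run-sound side r ms att)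

    meeting-points : ∀ side r → T (valid r) → Attained side r →
      Attained side twin × Attained side twin' × Attained side hub × Attained side crossed
    meeting-points side r v att = along side _ hub-to-twin at-hub , along side _ crossed-to-twin' at-crossed ,
                                  at-hub , at-crossed
      where
      at-hub : Attained side hub
      at-hub = along side schedule (schedule-ends-at-hub r v) att
      at-crossed : Attained side crossed
      at-crossed = along side _ hub-to-crossed at-hub

    attained-valid : ∀ side r → T (anchor ≻⟨ dissenter r ⟩ target) → Attained side r → T (valid r)
    attained-valid side r dissents (np , g≡t) =
      ∧-intro {np3 r} (np3-intro r comparisons) (∧-intro {not (excluded r target)} (not-intro admissible) dissents)
      where
      comparisons : ∀ ρ ρ' → ρ ≢ ρ' → T (someone r ρ ρ')
      comparisons ρ ρ' ρ≢ρ' with np (σ ρ) (σ ρ') (λ e → ρ≢ρ' (trans (sym (roleOf-σ ρ)) (trans (cong roleOf e) (roleOf-σ ρ'))))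
      ... | i , _ , pref , _ = seat-someone r (seatOf side i) (reads⁻ (interp-represents (seat r (seatOf side i))) pref)
      admissible : T (excluded r target) → ⊥
      admissible ex = never-excluded (embed side r) np
        (subst (Excluded (embed side r)) (sym g≡t) (excluded-hosted side (embed side r) r (embed-hosts side r) target ex))

    -- If neither pair voter ranks other above target, some voter w outside the pair does
    -- (NP), and then w ranks other, target, anchor in this order (Lemma A).
    lowered-witness : ∀ side p np → g p np ≡ t → ∀ {d l} →
      Represents (p (pairVoter side)) d → Represents (p (pairVoter (partner side))) l →
      T (not (other ≻⟨ d ⟩ target)) → T (not (other ≻⟨ l ⟩ target)) →
      Σ (Fin n) λ w → (∀ s → w ≢ pairVoter s) × T (witness (classify (p w)))
    lowered-witness side p np g≡t rep-d rep-l d-low l-low with np (third a t) t (proj₂ (third-fresh a≢t))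
    ... | w , _ , x≻t , _ = w , w-outside ,
      ∧-intro {other ≻⟨ classify (p w) ⟩ target} (reads⁻ (classify-represents (p w)) x≻t)
                                                (reads⁻ (classify-represents (p w)) t≻a)
      where
      w-outside : ∀ s → w ≢ pairVoter s
      w-outside s refl with side-or-partner side s
      ... | inj₁ refl = not-elim d-low (reads⁻ rep-d x≻t)
      ... | inj₂ refl = not-elim l-low (reads⁻ rep-l x≻t)
      t≻a : t ≻[ p w ] a
      t≻a with prefer-total (p w) t≢a
      ... | inj₁ t≻a = t≻a
      ... | inj₂ a≻t = ⊥-elim (outsiders-accept p np w (w-outside penultimate , w-outside ultimate)
                                 (subst (λ s → a ≻[ p w ] s) (sym g≡t) a≻t))

    -- Then moving the ally to tax keeps NP (w supplies other above anchor) and keeps the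
    -- outcome t, which tax ranks on top.
    ally-to-tax : ∀ side p np → g p np ≡ t → ∀ {d} → Represents (p (pairVoter side)) d → T (lowered d) →
      ∀ w → (∀ s → w ≢ pairVoter s) → T (witness (classify (p w))) →
      Σ (NP (p [ pairVoter (partner side) ≔ interp tax ])) λ np' → g (p [ pairVoter (partner side) ≔ interp tax ]) np' ≡ t
    ally-to-tax side p np g≡t {d} rep-d d-lowered w w-outside w-witness = np' , g'≡t
      where
      k = pairVoter (partner side)
      p' = p [ k ≔ interp tax ]
      witnesses : Witnessed p' ⟪ classify (p w) , d , tax ⟫
      witnesses blockSeat     = w , subst (λ R → Represents R (classify (p w)))
                                      (sym (update-elsewhere p (interp tax) w (w-outside (partner side)))) (classify-represents (p w))
      witnesses dissenterSeat = pairVoter side ,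
        subst (λ R → Represents R d) (sym (update-elsewhere p (interp tax) (pairVoter side) (pair-distinct side))) rep-d
      witnesses allySeat      = k , subst (λ R → Represents R tax) (sym (update-here p k (interp tax))) (interp-represents tax)
      np' : NP p'
      np' = np-witnessed p' ⟪ classify (p w) , d , tax ⟫ witnesses (lowered-np3 (classify (p w)) d w-witness d-lowered)
      g'≡t : g p' np' ≡ t
      g'≡t = is-target (g p' np') λ ρ ρ≢target σρ≡s →
        proj₂ (stable k np np' (update-variant p k (interp tax)))
          (subst₂ (λ u v → u ≻[ p' k ] v) (sym g≡t) σρ≡s
            (subst (λ R → t ≻[ R ] σ ρ) (sym (update-here p k (interp tax)))
              (reads (interp-represents tax) {target} {ρ} (target-on-top tax tt ρ ρ≢target))))

    -- If some pair voter ranks other above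
    -- target, the block takes the order crown d, which has the target on top.  Otherwise the
    -- ally first moves to tax, and then the block takes the order xta: its top alternative
    -- other is excluded, both pair voters ranking the anchor above it.
    collapse-with : ∀ side p np → g p np ≡ t → ∀ d l →
      Represents (p (pairVoter side)) d → Represents (p (pairVoter (partner side))) l → T (split d l) →
      Σ Profile3 λ r → T (anchor ≻⟨ dissenter r ⟩ target) × Attained side r
    collapse-with side p np g≡t d l rep-d rep-l split-dl
      with (other ≻⟨ d ⟩ target) ∨ (other ≻⟨ l ⟩ target) in others
    ... | true = ⟪ crown d , d , l ⟫ , ∧-left split-dl ,
      transport side p np g≡t ⟪ crown d , d , l ⟫ (pair-fits {side} {p} rep-d rep-l) (crown-np3 d l split-dl (subst T (sym others) tt))
        (λ ρ ρ≢target → inj₂ (∨-introˡ (target-on-top (crown d) (crown-on-top d) ρ ρ≢target)))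
    ... | false with lowered-witness side p np g≡t rep-d rep-l (proj₁ (nor others)) (proj₂ (nor {other ≻⟨ d ⟩ target} others))
    ...   | w , w-outside , w-witness
      with ally-to-tax side p np g≡t rep-d (∧-intro {anchor ≻⟨ d ⟩ target} (∧-left split-dl) (proj₁ (nor others))) w w-outside w-witness
    ...     | np' , g'≡t = ⟪ xta , d , tax ⟫ , ∧-left split-dl ,
      transport side p' np' g'≡t ⟪ xta , d , tax ⟫ (pair-fits {side} {p'} rep-d' rep-tax) (lowered-np3 xta d tt d-lowered) secure
      where
      k = pairVoter (partner side)
      p' = p [ k ≔ interp tax ]
      d-lowered : T (lowered d)
      d-lowered = ∧-intro {anchor ≻⟨ d ⟩ target} (∧-left split-dl) (proj₁ (nor others))
      rep-d' : Represents (p' (pairVoter side)) d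
      rep-d' = subst (λ R → Represents R d) (sym (update-elsewhere p (interp tax) (pairVoter side) (pair-distinct side))) rep-d
      rep-tax : Represents (p' k) tax
      rep-tax = subst (λ R → Represents R tax) (sym (update-here p k (interp tax))) (interp-represents tax)
      secure : Secure side p' ⟪ xta , d , tax ⟫
      secure anchor _ = inj₂ tt
      secure other  _ = inj₂ (lowered-excludes-other d d-lowered)
      secure target ρ≢target = ⊥-elim (ρ≢target refl)

    -- The pair voter ranking a above t is the dissenter; by Lemma E its partner ranks t
    -- above a.
    collapse-from : ∀ side p np → g p np ≡ t → a ≻[ p (pairVoter side) ] t →
                    Σ Profile3 λ r → T (anchor ≻⟨ dissenter r ⟩ target) × Attained side r
    collapse-from side p np g≡t a≻t =
      collapse-with side p np g≡t d l rep-d rep-l (∧-intro {anchor ≻⟨ d ⟩ target} dissents allies)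
      where
      d = classify (p (pairVoter side))
      l = classify (p (pairVoter (partner side)))
      rep-d = classify-represents (p (pairVoter side))
      rep-l = classify-represents (p (pairVoter (partner side)))
      dissents : T (anchor ≻⟨ d ⟩ target)
      dissents = reads⁻ rep-d a≻t
      allies : T (target ≻⟨ l ⟩ anchor)
      allies with prefer-total (p (pairVoter (partner side))) t≢a
      ... | inj₁ t≻a  = reads⁻ rep-l t≻a
      ... | inj₂ a≻'t = ⊥-elim (pair-once side p np (subst (λ s → a ≻[ p (pairVoter side) ] s) (sym g≡t) a≻t)
                                                 (subst (λ s → a ≻[ p (pairVoter (partner side)) ] s) (sym g≡t) a≻'t))

    -- Collapse: from any profile with outcome t, the voters outside the pair can be made to
    -- hold a common order while the outcome stays t.  Some voter ranks a above t (NP); by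
    -- Lemma A it is a pair voter.
    collapse : ∀ p np → g p np ≡ t →
      Σ Side λ side → Σ Profile3 λ r → T (anchor ≻⟨ dissenter r ⟩ target) × Attained side r
    collapse p np g≡t with np a t a≢t
    ... | i , _ , a≻t , _ with locate penultimate i
    ...   | inj₁ refl          = penultimate , collapse-from penultimate p np g≡t a≻t
    ...   | inj₂ (inj₁ refl)   = ultimate , collapse-from ultimate p np g≡t a≻t
    ...   | inj₂ (inj₂ outside) = ⊥-elim (outsiders-accept p np i outside (subst (λ s → a ≻[ p i ] s) (sym g≡t) a≻t))

    attained-everywhere : ∀ p np → g p np ≡ t →
      Σ Side λ s → Attained s twin × Attained s twin' × Attained s hub × Attained s crossed
    attained-everywhere p np g≡t with collapse p np g≡t
    ... | s , r , dissents , att = s , meeting-points s r (attained-valid s r dissents att) att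

  seat-partner : ∀ side r i → seat (swapPair r) (seatOf (partner side) i) ≡ seat r (seatOf side i)
  seat-partner side r i with locate side i
  ... | inj₁ refl =
    trans (cong (λ s → seat (swapPair r) (seatOf (partner side) (pairVoter s))) (sym (partner-involutive side)))
      (trans (cong (seat (swapPair r)) (seatOf-seatVoter (partner side) allySeat))
             (cong (seat r) (sym (seatOf-seatVoter side dissenterSeat))))
  ... | inj₂ (inj₁ refl) =
    trans (cong (seat (swapPair r)) (seatOf-seatVoter (partner side) dissenterSeat))
          (cong (seat r) (sym (seatOf-seatVoter side allySeat)))
  ... | inj₂ (inj₂ (ne₁ , ne₂)) =
    trans (cong (seat (swapPair r))
                (seatOf-outside (partner side) i ne₂ (subst (λ s → i ≢ pairVoter s) (sym (partner-involutive side)) ne₁)))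
          (cong (seat r) (sym (seatOf-outside side i ne₁ ne₂)))

  -- The frames of t and of the third alternative u read the same profiles with target and
  -- other exchanged: the realisation of r in the first agrees with that of relabel3 r in
  -- the second.
  module Reframe (t : X) (t≢a : t ≢ a) where
    module Fₜ = Frame t t≢a
    module Fᵤ = Frame (third a t) (proj₁ (third-fresh (≢-sym t≢a)))

    σ-swap : ∀ ρ → Fᵤ.σ ρ ≡ Fₜ.σ (swapRoles ρ)
    σ-swap anchor = refl
    σ-swap target = refl
    σ-swap other  = third-third (≢-sym t≢a)

    relabel-agrees : ∀ o → Agrees (Fₜ.interp o) (Fᵤ.interp (relabel o))
    relabel-agrees o = Fᵤ.same-code-agrees {Fₜ.interp o} (Fᵤ.represents placement) (Fᵤ.interp-represents (relabel o))
      where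
      placement : ∀ ρ → rank (Fₜ.interp o) (Fᵤ.σ ρ) ≡ position (relabel o) ρ
      placement ρ = trans (cong (rank (Fₜ.interp o)) (σ-swap ρ))
                          (trans (Fₜ.Represents.placed (Fₜ.interp-represents o) (swapRoles ρ)) (sym (relabel-position o ρ)))

    relabelled : ∀ side r i → Agrees (Fₜ.embed side r i) (Fᵤ.embed side (relabel3 r) i)
    relabelled side r i = subst (λ o → Agrees (Fₜ.interp (seat r (seatOf side i))) (Fᵤ.interp o))
                            (sym (seat-relabel3 r (seatOf side i))) (relabel-agrees (seat r (seatOf side i)))

    relabelled-partner : ∀ side r i → Agrees (Fₜ.embed side r i) (Fᵤ.embed (partner side) (swapPair (relabel3 r)) i)
    relabelled-partner side r i = subst (λ o → Agrees (Fₜ.embed side r i) (Fᵤ.interp o))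
                                    (sym (seat-partner side (relabel3 r) i)) (relabelled side r i)

    u≢t : third a t ≢ t
    u≢t = proj₂ (third-fresh (≢-sym t≢a))

    -- Two realisations that agree voter by voter have the same outcome, so t and the
    -- third alternative cannot be attained at the two readings of a meeting point.
    twins-clash : ∀ s → Fₜ.Attained s twin → Fᵤ.Attained s twin' → ⊥
    twins-clash s (nt , at-t) (nu , at-u) =
      u≢t (trans (sym at-u) (trans (sym (agreeing-profiles {Fₜ.embed s twin} {Fᵤ.embed s twin'} nt nu agree)) at-t))
      where
      agree : ∀ i → Agrees (Fₜ.embed s twin i) (Fᵤ.embed s twin' i)
      agree i = subst (λ r → Agrees (Fₜ.embed s twin i) (Fᵤ.embed s r i)) twins-meet (relabelled s twin i)

    crossings-clash : ∀ s → Fₜ.Attained s crossed → Fᵤ.Attained (partner s) hub → ⊥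
    crossings-clash s (nt , at-t) (nu , at-u) =
      u≢t (trans (sym at-u) (trans (sym (agreeing-profiles {Fₜ.embed s crossed} {Fᵤ.embed (partner s) hub} nt nu agree)) at-t))
      where
      agree : ∀ i → Agrees (Fₜ.embed s crossed i) (Fᵤ.embed (partner s) hub i)
      agree i = subst (λ r → Agrees (Fₜ.embed s crossed i) (Fᵤ.embed (partner s) r i)) crossings-meet
                  (relabelled-partner s crossed i)

    not-both-attained : (Σ (Profile n) λ p → Σ (NP p) λ np → g p np ≡ t) →
                        ¬ (Σ (Profile n) λ p → Σ (NP p) λ np → g p np ≡ third a t)
    not-both-attained (p , np , g≡t) (p' , np' , g≡u) =
      clash (Fₜ.attained-everywhere p np g≡t) (Fᵤ.attained-everywhere p' np' g≡u)
      where
      clash : (Σ Side λ s → Fₜ.Attained s twin × Fₜ.Attained s twin' × Fₜ.Attained s hub × Fₜ.Attained s crossed) →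
              (Σ Side λ s → Fᵤ.Attained s twin × Fᵤ.Attained s twin' × Fᵤ.Attained s hub × Fᵤ.Attained s crossed) → ⊥
      clash (s , at-twin , _ , _ , at-crossed) (s' , _ , at-twin' , at-hub , _) with side-or-partner s s'
      ... | inj₁ refl = twins-clash s at-twin at-twin'
      ... | inj₂ refl = crossings-clash s at-crossed at-hub

-- The theorem: two distinct values other than a cannot both be attained.
mainTheorem3 : (n : ℕ) (h : 3 ≤ n) (g : Rule n) → StrategyProof g →
    Σ X (λ a → RangeOnNP*IsSingleton n h g a) → ¬ FullRange g
mainTheorem3 n h g sp (a , _ , anchored) full =
  Reframe.not-both-attained (another a) (another-fresh a) (full (another a)) (full (third a (another a)))
  where
  open Analysis n h g sp a anchored
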